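{- Let $k\in\mathbb{N}$ and $n\in\mathbb{N}\cup\{\omega\}$ with $3\le k\le n$. Then: (1) if $n$ is finite, $Q(n,k)\ge \binom{n}{\lfloor (k-1)/2\rfloor}$; (2) if $n=\omega$, $Q(\omega,k)=+\infty$, i.e. $\mathbb{Z}_2^\omega$ cannot be partitioned into finitely many $k$-thin sets.
   Context: $\mathbb{N}=\{1,2,\dots\}$, $\omega=\{0,1,2,\dots\}$. For $n\in\mathbb{N}\cup\{\omega\}$, $\mathbb{Z}_2^n$ is the set of binary sequences indexed by $\{0,\dots,n-1\}$ (resp. by $\omega$ if $n=\omega$). The Hamming distance is $d_H(x,y):=|\{j: x(j)\ne y(j)\}|$ (possibly infinite when $n=\omega$). The minimum distance of $T\subseteq\mathbb{Z}_2^n$ is $\operatorname{HD}(T):=\inf\{d_H(x,y): x,y\in T,\ x\ne y\}$ (with $\inf\emptyset=+\infty$). A set $T\subseteq\mathbb{Z}_2^n$ is $k$-thin if $\operatorname{HD}(T)\ge k$. For $2\le k\le n$, $Q(n,k)$ denotes the smallest number $s$ (possibly $+\infty$) such that $\mathbb{Z}_2^n$ admits a partition into $s$ sets each of which is $k$-thin. -}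

module Defs where

open import Data.Nat using (ℕ; zero; suc; _+_; _≤_)
open import Data.Bool using (Bool; true; false)
open import Data.Fin using (Fin)
open import Data.Vec using (Vec; []; _∷_)
open import Data.Product using (Σ; _×_)
open import Relation.Binary.PropositionalEquality using (_≡_; _≢_)
open import Relation.Nullary using (¬_; Dec; yes; no)
open import Function.Definitions using (Injective)
import Data.Bool.Properties as BP

Z2 : ℕ → Set
Z2 n = Vec Bool n

Z2ω : Set
Z2ω = ℕ → Bool

dH : ∀ {n} → Z2 n → Z2 n → ℕ
dH [] [] = 0
dH (a ∷ x) (b ∷ y) with a BP.≟ b
... | yes _ = dH x y
... | no  _ = suc (dH x y)

ThinClass : ∀ {n s} → ℕ → (Z2 n → Fin s) → Fin s → Set
ThinClass {n} k c i =
  (x y : Z2 n) → c x ≡ i → c y ≡ i → x ≢ y → k ≤ dH x y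

-- A partition of ℤ₂ⁿ into s k-thin sets, given as a colouring with s colours
-- (the i-th part is the preimage of i).
ThinPartition : ℕ → ℕ → ℕ → Set
ThinPartition n k s = Σ (Z2 n → Fin s) λ c → (i : Fin s) → ThinClass k c i

-- For infinite sequences: d_H(x,y) ≥ k  iff  there are k distinct coordinates
-- at which x and y differ (d_H may be infinite).
HDω≥ : ℕ → Z2ω → Z2ω → Set
HDω≥ k x y = Σ (Fin k → ℕ) λ f → Injective _≡_ _≡_ f × ((j : Fin k) → x (f j) ≢ y (f j))

_≠ω_ : Z2ω → Z2ω → Set
x ≠ω y = ¬ ((i : ℕ) → x i ≡ y i)

ThinClassω : ∀ {s} → ℕ → (Z2ω → Fin s) → Fin s → Set
ThinClassω k c i =
  (x y : Z2ω) → c x ≡ i → c y ≡ i → x ≠ω y → HDω≥ k x y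

ThinPartitionω : ℕ → ℕ → Set
ThinPartitionω k s = Σ (Z2ω → Fin s) λ c → (i : Fin s) → ThinClassω k c i

-- Vectors of weight r are pairwise at Hamming distance at most 2r, so when 2r < k no two
-- of them can share a k-thin part: a partition of ℤ₂ⁿ into k-thin sets needs at least
-- n C r parts.  In ℤ₂^ω the unit vectors are pairwise at distance 2 < 3 ≤ k, and there are
-- infinitely many of them, so no finite partition into k-thin sets exists.
module Submission where

open import Defs
open import Data.Nat using (ℕ; zero; suc; _+_; _*_; _∸_; _≤_; _<_; z≤n; s≤s; _≡ᵇ_)
open import Data.Nat.Properties
  using (≤-trans; ≤-reflexive; <-irrefl; <⇒≱; m≤n⇒m≤1+n; n≤1+n; +-monoʳ-≤; +-suc; +-identityʳ;
         *-comm; ≡ᵇ⇒≡; ≡⇒≡ᵇ; module ≤-Reasoning)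
open import Data.Nat.DivMod using (_/_; m/n*n≤m)
open import Data.Nat.Combinatorics using (_C_; nCk+nC[k+1]≡[n+1]C[k+1])
open import Data.Nat.Combinatorics.Specification using (k>n⇒nCk≡0)
open import Data.Bool using (true; false; T)
open import Data.Fin as Fin using (Fin; splitAt; join; toℕ; _≟_)
open import Data.Fin.Properties using (injective⇒≤; join-splitAt; toℕ-injective; 0≢1+n)
open import Data.Vec using ([]; _∷_; replicate)
open import Data.Vec.Properties using (∷-injectiveˡ; ∷-injectiveʳ)
open import Data.Sum using (_⊎_; inj₁; inj₂; [_,_]′)
open import Data.Product using (_×_; ∃; _,_)
open import Function using (_∘_; const)
open import Function.Definitions using (Injective)
open import Relation.Nullary using (¬_; yes; no; contradiction)
open import Relation.Binary.PropositionalEquality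

thinPartition-clique≤ : ∀ {n k s m} → ThinPartition n k s →
  (f : Fin m → Z2 n) → Injective _≡_ _≡_ f → (∀ i j → dH (f i) (f j) < k) → m ≤ s
thinPartition-clique≤ (c , thin) f f-inj close = injective⇒≤ c∘f-injective
  where
  c∘f-injective : Injective _≡_ _≡_ (c ∘ f)
  c∘f-injective {i} {j} same with i ≟ j
  ... | yes i≡j = i≡j
  ... | no  i≢j = contradiction
    (thin (c (f i)) (f i) (f j) refl (sym same) (i≢j ∘ f-inj)) (<⇒≱ (close i j))

thinPartitionω-clique≤ : ∀ {k s m} → ThinPartitionω k s →
  (f : Fin m → Z2ω) → (∀ {i j} → i ≢ j → f i ≠ω f j) →
  (∀ i j → ¬ HDω≥ k (f i) (f j)) → m ≤ s
thinPartitionω-clique≤ (c , thin) f f-distinct far = injective⇒≤ c∘f-injective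
  where
  c∘f-injective : Injective _≡_ _≡_ (c ∘ f)
  c∘f-injective {i} {j} same with i ≟ j
  ... | yes i≡j = i≡j
  ... | no  i≢j = contradiction
    (thin (c (f i)) (f i) (f j) refl (sym same) (f-distinct i≢j)) (far i j)

weight : ∀ {n} → Z2 n → ℕ
weight [] = 0
weight (true ∷ x) = suc (weight x)
weight (false ∷ x) = weight x

dH≤weight+weight : ∀ {n} (x y : Z2 n) → dH x y ≤ weight x + weight y
dH≤weight+weight [] [] = z≤n
dH≤weight+weight (true ∷ x) (true ∷ y) =
  m≤n⇒m≤1+n (≤-trans (dH≤weight+weight x y) (+-monoʳ-≤ (weight x) (n≤1+n (weight y))))
dH≤weight+weight (true ∷ x) (false ∷ y) = s≤s (dH≤weight+weight x y)
dH≤weight+weight (false ∷ x) (true ∷ y) =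
  ≤-trans (s≤s (dH≤weight+weight x y)) (≤-reflexive (sym (+-suc (weight x) (weight y))))
dH≤weight+weight (false ∷ x) (false ∷ y) = dH≤weight+weight x y

-- Pascal's recursion, which the enumeration ofWeight of the weight-r vectors follows.
choose : ℕ → ℕ → ℕ
choose zero    zero    = 1
choose zero    (suc r) = 0
choose (suc n) zero    = 1
choose (suc n) (suc r) = choose n r + choose n (suc r)

choose≡C : ∀ n r → choose n r ≡ n C r
choose≡C zero    zero    = refl
choose≡C zero    (suc r) = sym (k>n⇒nCk≡0 {0} {suc r} (s≤s z≤n))
choose≡C (suc n) zero    = refl
choose≡C (suc n) (suc r) =
  trans (cong₂ _+_ (choose≡C n r) (choose≡C n (suc r))) (nCk+nC[k+1]≡[n+1]C[k+1] n r)

ofWeight : ∀ n r → Fin (choose n r) → Z2 n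
ofWeight zero    zero    _ = []
ofWeight (suc n) zero    _ = replicate (suc n) false
ofWeight (suc n) (suc r) i =
  [ (true ∷_) ∘ ofWeight n r , (false ∷_) ∘ ofWeight n (suc r) ]′ (splitAt (choose n r) i)

weight-replicate-false : ∀ n → weight (replicate n false) ≡ 0
weight-replicate-false zero    = refl
weight-replicate-false (suc n) = weight-replicate-false n

weight-ofWeight : ∀ n r i → weight (ofWeight n r i) ≡ r
weight-ofWeight zero    zero    _ = refl
weight-ofWeight (suc n) zero    _ = weight-replicate-false n
weight-ofWeight (suc n) (suc r) i with splitAt (choose n r) i
... | inj₁ a = cong suc (weight-ofWeight n r a)
... | inj₂ b = weight-ofWeight n (suc r) b

splitAt-injective : ∀ m {n} → Injective _≡_ _≡_ (splitAt m {n})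
splitAt-injective m {n} {i} {j} eq =
  trans (sym (join-splitAt m n i)) (trans (cong (join m n) eq) (join-splitAt m n j))

ofWeight-injective : ∀ n r → Injective _≡_ _≡_ (ofWeight n r)
ofWeight-injective zero    zero    {Fin.zero} {Fin.zero} _ = refl
ofWeight-injective (suc n) zero    {Fin.zero} {Fin.zero} _ = refl
ofWeight-injective (suc n) (suc r) {i} {j} eq
  with splitAt (choose n r) i in split-i | splitAt (choose n r) j in split-j
... | inj₁ a | inj₁ b = splitAt-injective (choose n r) (trans split-i (trans
  (cong inj₁ (ofWeight-injective n r (∷-injectiveʳ eq))) (sym split-j)))
... | inj₂ a | inj₂ b = splitAt-injective (choose n r) (trans split-i (trans
  (cong inj₂ (ofWeight-injective n (suc r) (∷-injectiveʳ eq))) (sym split-j)))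
... | inj₁ _ | inj₂ _ = contradiction (∷-injectiveˡ eq) λ ()
... | inj₂ _ | inj₁ _ = contradiction (∷-injectiveˡ eq) λ ()

thinPartition-C≤ : ∀ {n k s} r → 2 * r < k → ThinPartition n k s → n C r ≤ s
thinPartition-C≤ {n} {k} r 2r<k partition = subst (_≤ _) (choose≡C n r)
  (thinPartition-clique≤ partition (ofWeight n r) (ofWeight-injective n r) close)
  where
  close : ∀ i j → dH (ofWeight n r i) (ofWeight n r j) < k
  close i j = begin-strict
    dH (ofWeight n r i) (ofWeight n r j)           ≤⟨ dH≤weight+weight (ofWeight n r i) (ofWeight n r j) ⟩
    weight (ofWeight n r i) + weight (ofWeight n r j)
      ≡⟨ cong₂ _+_ (weight-ofWeight n r i) (weight-ofWeight n r j) ⟩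
    r + r                                          ≡⟨ cong (r +_) (sym (+-identityʳ r)) ⟩
    2 * r                                          <⟨ 2r<k ⟩
    k                                              ∎
    where open ≤-Reasoning

2*[[k∸1]/2]<k : ∀ {k} → 1 ≤ k → 2 * ((k ∸ 1) / 2) < k
2*[[k∸1]/2]<k {suc k} _ = s≤s (≤-trans (≤-reflexive (*-comm 2 (k / 2))) (m/n*n≤m k 2))

unit : ℕ → Z2ω
unit a m = a ≡ᵇ m

unit-injective : ∀ {a b} → a ≢ b → unit a ≠ω unit b
unit-injective {a} {b} a≢b same = a≢b (sym (≡ᵇ⇒≡ b a (subst T (same a) (≡⇒≡ᵇ a a refl))))

unit-support : ∀ a b m → unit a m ≢ unit b m → m ≡ a ⊎ m ≡ b
unit-support a b m differ with a ≡ᵇ m in a≡ᵇm | b ≡ᵇ m in b≡ᵇm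
... | true  | _     = inj₁ (sym (≡ᵇ⇒≡ a m (subst T (sym a≡ᵇm) _)))
... | false | true  = inj₂ (sym (≡ᵇ⇒≡ b m (subst T (sym b≡ᵇm) _)))
... | false | false = contradiction refl differ

injective-into-pair⇒≤2 : ∀ {k a b} (f : Fin k → ℕ) → Injective _≡_ _≡_ f →
  (∀ j → f j ≡ a ⊎ f j ≡ b) → k ≤ 2
injective-into-pair⇒≤2 {k} f f-inj into = injective⇒≤ side-injective
  where
  side : Fin k → Fin 2
  side j = [ const Fin.zero , const (Fin.suc Fin.zero) ]′ (into j)

  side-injective : Injective _≡_ _≡_ side
  side-injective {i} {j} same with into i | into j
  ... | inj₁ p | inj₁ q = f-inj (trans p (sym q))
  ... | inj₂ p | inj₂ q = f-inj (trans p (sym q))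
  ... | inj₁ _ | inj₂ _ = contradiction same 0≢1+n
  ... | inj₂ _ | inj₁ _ = contradiction (sym same) 0≢1+n

¬HDω≥-unit : ∀ {k} a b → 3 ≤ k → ¬ HDω≥ k (unit a) (unit b)
¬HDω≥-unit a b 3≤k (f , f-inj , differ) =
  <⇒≱ 3≤k (injective-into-pair⇒≤2 f f-inj (λ j → unit-support a b (f j) (differ j)))

¬thinPartitionω : ∀ {k s} → 3 ≤ k → ¬ ThinPartitionω k s
¬thinPartitionω {s = s} 3≤k partition = <-irrefl refl (thinPartitionω-clique≤ partition
  (unit ∘ toℕ {suc s}) (unit-injective ∘ (_∘ toℕ-injective))
  (λ i j → ¬HDω≥-unit (toℕ i) (toℕ j) 3≤k))

mainTheorem13 : (k : ℕ) → 3 ≤ k →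
    ((n : ℕ) → k ≤ n → (s : ℕ) → ThinPartition n k s → n C ((k ∸ 1) / 2) ≤ s)
    × ¬ (∃ λ (s : ℕ) → ThinPartitionω k s)
mainTheorem13 k 3≤k =
  (λ _ _ _ → thinPartition-C≤ ((k ∸ 1) / 2) (2*[[k∸1]/2]<k (≤-trans (s≤s z≤n) 3≤k))) ,
  λ (_ , partition) → ¬thinPartitionω 3≤k partition
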